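{- Suppose $G$ is a caterpillar. Then $G$ is the incomparability graph of a $2$-chain $P$, which is unique up to duality.
   Context: All posets and graphs are finite; partial orders are written $\preceq$. A poset $(P,\preceq)$ is a $2$-chain if (1) there is a unique way to write $P$ as the union of two chains, and (2) $\preceq$ is maximal subject to (1), i.e. for every proper refinement $\preceq^+$ of $\preceq$ there is more than one way to write $P$ as the union of two $\preceq^+$-chains. The incomparability graph of $P$ has vertex set $P$ with an edge between $p$ and $q$ iff $p\not\preceq q\not\preceq p$. A caterpillar is a tree whose non-leaf vertices form a path. "Unique up to duality" means unique up to isomorphism and replacing $P$ by its dual poset. -}

module Defs where

open import Data.Nat using (ℕ; zero; suc)
open import Data.Fin using (Fin; zero; suc; toℕ; inject₁; fromℕ)
open import Data.Bool using (Bool; true; false; not)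
open import Data.Product using (Σ; ∃; ∃-syntax; _×_; _,_)
open import Data.Sum using (_⊎_)
open import Relation.Nullary using (¬_)
open import Relation.Binary.PropositionalEquality using (_≡_; _≢_)
open import Function.Bundles using (_↔_; Inverse; _⇔_)
open import Function.Definitions using (Injective)

record Graph (n : ℕ) : Set where
  field
    adj     : Fin n → Fin n → Bool
    adj-sym : ∀ i j → adj i j ≡ true → adj j i ≡ true
    adj-irr : ∀ i → adj i i ≡ false
open Graph public

module _ {n : ℕ} (G : Graph n) where

  Adj : Fin n → Fin n → Set
  Adj i j = adj G i j ≡ true

  data Walk : Fin n → Fin n → Set where
    here : ∀ {x} → Walk x x
    step : ∀ {x y z} → Adj x y → Walk y z → Walk x z

  Connected : Set
  Connected = ∀ x y → Walk x y

  IsCycle : ∀ {k} → (Fin (suc (suc (suc k))) → Fin n) → Set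
  IsCycle {k} f =
    Injective _≡_ _≡_ f
    × (∀ (i : Fin (suc (suc k))) → Adj (f (inject₁ i)) (f (suc i)))
    × Adj (f (fromℕ (suc (suc k)))) (f zero)

  Acyclic : Set
  Acyclic = ∀ k (f : Fin (suc (suc (suc k))) → Fin n) → ¬ IsCycle f

  -- a tree: a nonempty connected acyclic graph
  Tree : Set
  Tree = Fin n × Connected × Acyclic

  Leaf : Fin n → Set
  Leaf i = ∃[ j ] (Adj i j × (∀ k → Adj i k → k ≡ j))

  NonLeavesFormPath : Set
  NonLeavesFormPath =
    ∃[ k ] Σ (Fin k → Fin n) λ f →
      Injective _≡_ _≡_ f
      × (∀ i → ¬ Leaf (f i))
      × (∀ v → ¬ Leaf v → ∃[ i ] f i ≡ v)
      × (∀ i j → Adj (f i) (f j) ⇔ (toℕ j ≡ suc (toℕ i) ⊎ toℕ i ≡ suc (toℕ j)))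

  Caterpillar : Set
  Caterpillar = Tree × NonLeavesFormPath

record FinPoset (m : ℕ) : Set where
  field
    le       : Fin m → Fin m → Bool
    le-refl  : ∀ i → le i i ≡ true
    le-antisym : ∀ i j → le i j ≡ true → le j i ≡ true → i ≡ j
    le-trans : ∀ i j k → le i j ≡ true → le j k ≡ true → le i k ≡ true
open FinPoset public

module _ {m : ℕ} (P : FinPoset m) where

  Comparable : Fin m → Fin m → Set
  Comparable i j = le P i j ≡ true ⊎ le P j i ≡ true

  Incomparable : Fin m → Fin m → Set
  Incomparable i j = le P i j ≡ false × le P j i ≡ false

  -- a way of writing P as a union of two (disjoint) chains, encoded by
  -- the colouring c : each colour class is a chain.  The colourings c
  -- and (not ∘ c) describe the same (unordered) way.
  TwoChainCover : (Fin m → Bool) → Set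
  TwoChainCover c = ∀ i j → c i ≡ c j → Comparable i j

  SameWay : (Fin m → Bool) → (Fin m → Bool) → Set
  SameWay c c' = (∀ i → c' i ≡ c i) ⊎ (∀ i → c' i ≡ not (c i))

  UniqueTwoChainCover : Set
  UniqueTwoChainCover =
    Σ (Fin m → Bool) λ c → TwoChainCover c
      × (∀ c' → TwoChainCover c' → SameWay c c')

  MoreThanOneTwoChainCover : Set
  MoreThanOneTwoChainCover =
    Σ (Fin m → Bool) λ c → Σ (Fin m → Bool) λ c' →
      TwoChainCover c × TwoChainCover c' × ¬ SameWay c c'

ProperRefinement : ∀ {m} → FinPoset m → FinPoset m → Set
ProperRefinement P Q =
  (∀ i j → le P i j ≡ true → le Q i j ≡ true)
  × ∃[ i ] ∃[ j ] (le P i j ≡ false × le Q i j ≡ true)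

IsTwoChain : ∀ {m} → FinPoset m → Set
IsTwoChain {m} P =
  UniqueTwoChainCover P
  × (∀ (Q : FinPoset m) → ProperRefinement P Q → MoreThanOneTwoChainCover Q)

IsIncomparabilityGraphOf : ∀ {n m} → Graph n → FinPoset m → Set
IsIncomparabilityGraphOf {n} {m} G P =
  Σ (Fin n ↔ Fin m) λ φ →
    ∀ i j → Adj G i j ⇔ Incomparable P (Inverse.to φ i) (Inverse.to φ j)

dual : ∀ {m} → FinPoset m → FinPoset m
dual P = record
  { le = λ i j → le P j i
  ; le-refl = le-refl P
  ; le-antisym = λ i j p q → le-antisym P i j q p
  ; le-trans = λ i j k p q → le-trans P k j i q p
  }

_≅_ : ∀ {m k} → FinPoset m → FinPoset k → Set
_≅_ {m} {k} P Q =
  Σ (Fin m ↔ Fin k) λ φ →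
    ∀ i j → le P i j ≡ le Q (Inverse.to φ i) (Inverse.to φ j)

module Submission where

-- Number the spine 0, …, t and put spine vertex i into block 2i and its leaves into
-- block 2i+1. Adjacent vertices then have blocks {2i, 2i+1} or {2i, 2i+2}, so listing the
-- vertices by block gives an ordering without umbrellas (x ≺ y ≺ z with x ~ z forces
-- x ~ y or y ~ z), and "x ≤ y iff x = y, or x ≺ y and x ≁ y" is a partial order with
-- incomparability graph G. Colouring the blocks alternately gives a 2-chain cover, unique
-- because G is connected; the order is maximal because every edge of a tree is a bridge,
-- so a refinement ordering the ends of an edge has a second cover, obtained by swapping
-- colours on one side of that bridge. Conversely, Gallai's forcing (if x is comparable to
-- y and to z but y ∥ z, then x ≤ y iff x ≤ z) propagates the orientation of a single pair
-- to every comparable pair with increasing blocks, so any poset with incomparability graph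
-- G, or its dual, orders such pairs by block. Blocks are chains in both orders, and matching
-- ranks in the two linear extensions yields the isomorphism.

open import Defs
open import Level using (0ℓ)
open import Data.Nat using (ℕ; zero; suc; z≤n; s≤s; _≤_; _<_; _≤?_; _<?_)
open import Data.Nat.Properties
  using ( <-cmp; module ≤-Reasoning; ≤-refl; ≤-trans; ≤-<-trans; <-trans; ≤-antisym; ≤-pred
        ; <-irrefl; <-asym; <⇒≢; <⇒≱; ≮⇒≥; ≰⇒>; ≤∧≢⇒<; n≤0⇒n≡0; n<1+n; n≤1+n; 1+n≰n
        ; m≤n⇒m≤1+n; m<n⇒m<1+n; m≤n⇒m<n∨m≡n; suc-injective )
open import Data.Fin as Fin using (Fin; zero; suc; toℕ; fromℕ; fromℕ<; punchOut)
open import Data.Fin.Properties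
  using (¬Fin0; any?; all?; toℕ<n; toℕ-fromℕ; toℕ-fromℕ<; toℕ-injective; punchOut-injective; injective⇒≤)
open import Data.Bool using (Bool; true; false; not; _xor_; if_then_else_)
open import Data.Bool.Properties using (¬-not; not-¬; not-injective; xor-annihilates-not)
import Data.Bool.Properties as Bool
open import Data.Product using (Σ; ∃; ∃-syntax; _×_; _,_; proj₁; proj₂; map₂; swap)
open import Data.Sum using (_⊎_; inj₁; inj₂; [_,_])
open import Data.Unit using (tt)
open import Relation.Nullary using (¬_; Dec; yes; no; does; contradiction)
open import Relation.Nullary.Decidable
  using (decidable-stable; dec-true; dec-false; _⊎-dec_; _×-dec_; _→-dec_; ¬?)
open import Relation.Unary using (Pred; Decidable; _⊆_)
open import Relation.Binary
  using (Rel; Transitive; Trichotomous; Tri; tri<; tri≈; tri>; IsStrictTotalOrder; isStrictTotalOrderᶜ)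
open import Relation.Binary.PropositionalEquality
  using (_≡_; _≢_; refl; sym; trans; cong; cong₂; subst; subst₂; isEquivalence; module ≡-Reasoning)
open import Function using (_∘_; _∘₂_)
open import Function.Bundles using (_↔_; Inverse; Injection; _⇔_; mk⇔; mk↔ₛ′; Equivalence)
open import Function.Definitions using (Injective)
open import Function.Properties.Inverse using (↔-refl; ↔-sym; ↔-trans; ↔⇒↣)

open Inverse using (to; from; strictlyInverseˡ)
open Equivalence using () renaming (to to ⇒; from to ⇐)


true⇔true⇒≡ : ∀ {a b : Bool} → (a ≡ true → b ≡ true) → (b ≡ true → a ≡ true) → a ≡ b
true⇔true⇒≡ {true}  {true}  _ _ = refl
true⇔true⇒≡ {true}  {false} f _ = sym (f refl)
true⇔true⇒≡ {false} {true}  _ g = g refl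
true⇔true⇒≡ {false} {false} _ _ = refl

does⇒ : ∀ {A : Set} (a? : Dec A) → does a? ≡ true → A
does⇒ (yes a) _ = a

xor-cancelˡ : ∀ a {b c} → a xor b ≡ a xor c → b ≡ c
xor-cancelˡ false e = e
xor-cancelˡ true  e = not-injective e

xor≡false⇒≡ : ∀ a b → a xor b ≡ false → b ≡ a
xor≡false⇒≡ false false _ = refl
xor≡false⇒≡ true  true  _ = refl

xor≡true⇒≡not : ∀ a b → a xor b ≡ true → b ≡ not a
xor≡true⇒≡not false true  _ = refl
xor≡true⇒≡not true  false _ = refl

xor≡self⇒false : ∀ {a} b → a xor b ≡ b → a ≡ false
xor≡self⇒false {false} _ _ = refl
xor≡self⇒false {true}  b e = contradiction (sym e) (not-¬ refl)

xor≡not⇒true : ∀ {a} b → a xor b ≡ not b → a ≡ true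
xor≡not⇒true {true}  _ _ = refl
xor≡not⇒true {false} b e = contradiction e (not-¬ refl)

module _ {n : ℕ} (G : Graph n) where

  adj-irrefl : ∀ {x} → ¬ Adj G x x
  adj-irrefl {x} = not-¬ (adj-irr G x)

  walk-invariant : ∀ {A : Set} (f : Fin n → A) → (∀ {x y} → Adj G x y → f x ≡ f y) →
    ∀ {x y} → Walk G x y → f x ≡ f y
  walk-invariant f inv here       = refl
  walk-invariant f inv (step a w) = trans (inv a) (walk-invariant f inv w)

  LeafAt : Fin n → Fin n → Set
  LeafAt x w = Adj G x w × (∀ z → Adj G x z → z ≡ w)

  leaf? : ∀ x → Dec (Leaf G x)
  leaf? x = any? λ w → (adj G x w Bool.≟ true) ×-dec all? λ z → (adj G x z Bool.≟ true) →-dec (z Fin.≟ w)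

  adjacent-leaves-span : Connected G → ∀ {x w} → LeafAt x w → Leaf G w → ∀ u → u ≡ x ⊎ u ≡ w
  adjacent-leaves-span conn {x} {w} (x~w , only-w) (w' , _ , only-w') u = stays (inj₁ refl) (conn x u)
    where
    only-x : ∀ z → Adj G w z → z ≡ x
    only-x z w~z = trans (only-w' z w~z) (sym (only-w' x (adj-sym G x w x~w)))
    stays : ∀ {a u} → a ≡ x ⊎ a ≡ w → Walk G a u → u ≡ x ⊎ u ≡ w
    stays a∈ here                = a∈
    stays (inj₁ refl) (step a~b walk) = stays (inj₂ (only-w _ a~b)) walk
    stays (inj₂ refl) (step a~b walk) = stays (inj₁ (only-x _ a~b)) walk

  ProperColouring : (Fin n → Bool) → Set
  ProperColouring c = ∀ {x y} → Adj G x y → c x ≢ c y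


colouring-xor-constant : ∀ {n} (G : Graph n) → Connected G → ∀ {c c'} →
  ProperColouring G c → ProperColouring G c' → ∀ x y → c x xor c' x ≡ c y xor c' y
colouring-xor-constant G conn {c} {c'} pc pc' x y = walk-invariant G (λ z → c z xor c' z) edge (conn x y)
  where
  edge : ∀ {x y} → Adj G x y → c x xor c' x ≡ c y xor c' y
  edge {x} {y} a = begin
    c x xor c' x             ≡⟨ sym (xor-annihilates-not (c x) (c' x)) ⟩
    not (c x) xor not (c' x) ≡⟨ cong₂ _xor_ (sym (¬-not (pc a ∘ sym))) (sym (¬-not (pc' a ∘ sym))) ⟩
    c y xor c' y             ∎
    where open ≡-Reasoning

proper-2-colouring-unique : ∀ {n} (G : Graph n) → Connected G → ∀ {c c'} →
  ProperColouring G c → ProperColouring G c' → (∀ x → c' x ≡ c x) ⊎ (∀ x → c' x ≡ not (c x))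
proper-2-colouring-unique {zero}  G conn pc pc' = inj₁ λ ()
proper-2-colouring-unique {suc n} G conn {c} {c'} pc pc' with c zero xor c' zero in d₀
... | false = inj₁ λ x → xor≡false⇒≡ _ _ (trans (sym (colouring-xor-constant G conn pc pc' zero x)) d₀)
... | true  = inj₂ λ x → xor≡true⇒≡not _ _ (trans (sym (colouring-xor-constant G conn pc pc' zero x)) d₀)

≅-sym : ∀ {m k} {P : FinPoset m} {Q : FinPoset k} → P ≅ Q → Q ≅ P
≅-sym {P = P} {Q} (φ , h) = ↔-sym φ , λ i j → sym (begin
  le P (from φ i) (from φ j)               ≡⟨ h (from φ i) (from φ j) ⟩
  le Q (to φ (from φ i)) (to φ (from φ j)) ≡⟨ cong₂ (le Q) (strictlyInverseˡ φ i) (strictlyInverseˡ φ j) ⟩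
  le Q i j                                 ∎)
  where open ≡-Reasoning

≅-trans : ∀ {m k l} {P : FinPoset m} {Q : FinPoset k} {R : FinPoset l} → P ≅ Q → Q ≅ R → P ≅ R
≅-trans (φ , h) (ψ , k) = ↔-trans φ ψ , λ i j → trans (h i j) (k (to φ i) (to φ j))

dual-≅ : ∀ {m k} {P : FinPoset m} {Q : FinPoset k} → P ≅ Q → dual P ≅ dual Q
dual-≅ (φ , h) = φ , λ i j → h j i

pullback : ∀ {n m} → FinPoset m → Fin n ↔ Fin m → FinPoset n
pullback P φ = record
  { le         = λ x y → le P (to φ x) (to φ y)
  ; le-refl    = λ x → le-refl P (to φ x)
  ; le-antisym = λ x y p q → Injection.injective (↔⇒↣ φ) (le-antisym P (to φ x) (to φ y) p q)
  ; le-trans   = λ x y z → le-trans P (to φ x) (to φ y) (to φ z)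
  }

pullback-≅ : ∀ {n m} (P : FinPoset m) (φ : Fin n ↔ Fin m) → pullback P φ ≅ P
pullback-≅ P φ = φ , λ _ _ → refl

≅-up-to-duality : ∀ {m k l} {P : FinPoset m} {Q : FinPoset k} {C : FinPoset l} →
  (P ≅ C) ⊎ (P ≅ dual C) → (Q ≅ C) ⊎ (Q ≅ dual C) → (P ≅ Q) ⊎ (P ≅ dual Q)
≅-up-to-duality {P = P} {Q} {C} (inj₁ p) (inj₁ q) =
  inj₁ (≅-trans {P = P} {C} {Q} p (≅-sym {P = Q} {C} q))
≅-up-to-duality {P = P} {Q} {C} (inj₁ p) (inj₂ q) =
  inj₂ (≅-trans {P = P} {C} {dual Q} p (≅-sym {P = dual Q} {C} (dual-≅ {P = Q} {dual C} q)))
≅-up-to-duality {P = P} {Q} {C} (inj₂ p) (inj₁ q) =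
  inj₂ (≅-trans {P = P} {dual C} {dual Q} p (≅-sym {P = dual Q} {dual C} (dual-≅ {P = Q} {C} q)))
≅-up-to-duality {P = P} {Q} {C} (inj₂ p) (inj₂ q) =
  inj₁ (≅-trans {P = P} {dual C} {Q} p (≅-sym {P = Q} {dual C} q))

module _ {m : ℕ} (P : FinPoset m) where

  comparable-or-incomparable : ∀ x y → Comparable P x y ⊎ Incomparable P x y
  comparable-or-incomparable x y with le P x y | le P y x
  ... | true  | _     = inj₁ (inj₁ refl)
  ... | false | true  = inj₁ (inj₂ refl)
  ... | false | false = inj₂ (refl , refl)

  comparable⇒¬incomparable : ∀ {x y} → Comparable P x y → ¬ Incomparable P x y
  comparable⇒¬incomparable (inj₁ p) (q , _) = not-¬ q p
  comparable⇒¬incomparable (inj₂ p) (_ , q) = not-¬ q p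

  le-forcedʳ : ∀ {x y z} → Comparable P x y → Comparable P x z → Incomparable P y z →
    le P x y ≡ le P x z
  le-forcedʳ {x} {y} {z} cxy cxz (y≰z , z≰y) = true⇔true⇒≡ (pass cxz z≰y) (pass cxy y≰z)
    where
    pass : ∀ {u v} → Comparable P x v → le P v u ≡ false → le P x u ≡ true → le P x v ≡ true
    pass (inj₁ x≤v) _   _   = x≤v
    pass (inj₂ v≤x) v≰u x≤u = contradiction (le-trans P _ x _ v≤x x≤u) (not-¬ v≰u)

  le-forcedˡ : ∀ {x y z} → Comparable P x z → Comparable P y z → Incomparable P x y →
    le P x z ≡ le P y z
  le-forcedˡ {x} {y} {z} cxz cyz (x≰y , y≰x) = true⇔true⇒≡ (pass cyz x≰y) (pass cxz y≰x)
    where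
    pass : ∀ {u v} → Comparable P v z → le P u v ≡ false → le P u z ≡ true → le P v z ≡ true
    pass (inj₁ v≤z) _   _   = v≤z
    pass (inj₂ z≤v) u≰v u≤z = contradiction (le-trans P _ z _ u≤z z≤v) (not-¬ u≰v)

  cover-separates : ∀ {c} → TwoChainCover P c → ∀ {x y} → Incomparable P x y → c x ≢ c y
  cover-separates cov inc e = comparable⇒¬incomparable (cov _ _ e) inc

IncomparabilityGraph : ∀ {n} → Graph n → FinPoset n → Set
IncomparabilityGraph G P = ∀ x y → Adj G x y ⇔ Incomparable P x y

incomparabilityGraph-dual : ∀ {n} {G : Graph n} {P : FinPoset n} →
  IncomparabilityGraph G P → IncomparabilityGraph G (dual P)
incomparabilityGraph-dual incG x y = mk⇔ (swap ∘ ⇒ (incG x y)) (⇐ (incG x y) ∘ swap)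

BridgeCut : ∀ {n} → Graph n → Fin n → Fin n → (Fin n → Bool) → Set
BridgeCut G i j S =
  S i ≢ S j × (∀ {x y} → Adj G x y → S x ≢ S y → (x ≡ i × y ≡ j) ⊎ (x ≡ j × y ≡ i))

BridgeCut-sym : ∀ {n} {G : Graph n} {i j S} → BridgeCut G i j S → BridgeCut G j i S
BridgeCut-sym (Si≢Sj , crossing) = Si≢Sj ∘ sym , Data.Sum.swap ∘₂ crossing

leaf-bridgeCut : ∀ {n} (G : Graph n) {u w} → Adj G u w → (∀ {y} → Adj G w y → y ≡ u) →
  BridgeCut G u w (λ x → does (x Fin.≟ w))
leaf-bridgeCut G {u} {w} u~w unique = Su≢Sw , crossing
  where
  u≢w : u ≢ w
  u≢w refl = adj-irrefl G u~w
  Su≢Sw : does (u Fin.≟ w) ≢ does (w Fin.≟ w)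
  Su≢Sw e = not-¬ (dec-false (u Fin.≟ w) u≢w) (trans e (dec-true (w Fin.≟ w) refl))
  crossing : ∀ {x y} → Adj G x y → does (x Fin.≟ w) ≢ does (y Fin.≟ w) →
    (x ≡ u × y ≡ w) ⊎ (x ≡ w × y ≡ u)
  crossing {x} {y} x~y Sx≢Sy with x Fin.≟ w | y Fin.≟ w
  ... | yes refl | no _    = inj₂ (refl , unique x~y)
  ... | no _     | yes refl = inj₁ (unique (adj-sym G x w x~y) , refl)
  ... | yes _    | yes _    = contradiction refl Sx≢Sy
  ... | no _     | no _     = contradiction refl Sx≢Sy

module _ {n : ℕ} {G : Graph n} {P : FinPoset n} (incG : IncomparabilityGraph G P) where

  cover-unique : Connected G → ∀ {c} → TwoChainCover P c →
    ∀ c' → TwoChainCover P c' → SameWay P c c'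
  cover-unique conn cov c' cov' = proper-2-colouring-unique G conn (proper cov) (proper cov')
    where
    proper : ∀ {c} → TwoChainCover P c → ProperColouring G c
    proper cov a = cover-separates P cov (⇒ (incG _ _) a)

  refinement-splits-cover : ∀ {c S i j} (Q : FinPoset n) → TwoChainCover P c → BridgeCut G i j S →
    (∀ x y → le P x y ≡ true → le Q x y ≡ true) → le Q i j ≡ true → MoreThanOneTwoChainCover Q
  refinement-splits-cover {c} {S} {i} {j} Q cov (Si≢Sj , bridge) P⊆Q i≤j =
    c , c' , (λ x y → lift ∘ cov x y) , cov' , different
    where
    c' : Fin n → Bool
    c' x = S x xor c x
    lift : ∀ {x y} → Comparable P x y → Comparable Q x y
    lift (inj₁ x≤y) = inj₁ (P⊆Q _ _ x≤y)
    lift (inj₂ y≤x) = inj₂ (P⊆Q _ _ y≤x)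
    cov' : TwoChainCover Q c'
    cov' x y e with comparable-or-incomparable P x y
    ... | inj₁ cmp = lift cmp
    ... | inj₂ inc with bridge (⇐ (incG x y) inc) (λ Sx≡Sy →
          cover-separates P cov inc (xor-cancelˡ (S x) (trans e (cong (_xor c y) (sym Sx≡Sy)))))
    ...   | inj₁ (refl , refl) = inj₁ i≤j
    ...   | inj₂ (refl , refl) = inj₂ i≤j
    different : ¬ SameWay Q c c'
    different (inj₁ c'≡c)    = Si≢Sj (trans (xor≡self⇒false _ (c'≡c i)) (sym (xor≡self⇒false _ (c'≡c j))))
    different (inj₂ c'≡notc) = Si≢Sj (trans (xor≡not⇒true _ (c'≡notc i)) (sym (xor≡not⇒true _ (c'≡notc j))))

  refinement-incomparable : ∀ {Q} → ProperRefinement P Q →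
    ∃[ i ] ∃[ j ] Incomparable P i j × le Q i j ≡ true
  refinement-incomparable {Q} (P⊆Q , i , j , i≰j , i≤j) = i , j , (i≰j , j≰i) , i≤j
    where
    j≰i : le P j i ≡ false
    j≰i = ¬-not λ j≤i →
      not-¬ (subst (λ k → le P i k ≡ false) (sym (le-antisym Q i j i≤j (P⊆Q j i j≤i))) i≰j) (le-refl P i)

  two-chain-criterion : Connected G → ∀ {c} → TwoChainCover P c →
    (∀ {i j} → Adj G i j → ∃ (BridgeCut G i j)) → IsTwoChain P
  two-chain-criterion conn {c} cov bridges =
    (c , cov , cover-unique conn cov) , maximal
    where
    maximal : ∀ Q → ProperRefinement P Q → MoreThanOneTwoChainCover Q
    maximal Q ref with refinement-incomparable {Q} ref
    ... | i , j , inc , i≤j =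
      refinement-splits-cover Q cov (proj₂ (bridges (⇐ (incG i j) inc))) (proj₁ ref) i≤j

-- Umbrella-free orderings

isStrictTotalOrder-≡ : ∀ {A : Set} {_≺_ : Rel A 0ℓ} → (∀ {x} → ¬ x ≺ x) → Transitive _≺_ →
  (∀ x y → x ≡ y ⊎ x ≺ y ⊎ y ≺ x) → IsStrictTotalOrder _≡_ _≺_
isStrictTotalOrder-≡ {_≺_ = _≺_} irr ≺-trans total = isStrictTotalOrderᶜ record
  { isEquivalence = isEquivalence
  ; trans         = ≺-trans
  ; compare       = compare
  }
  where
  asym : ∀ {x y} → x ≺ y → ¬ y ≺ x
  asym x≺y y≺x = irr (≺-trans x≺y y≺x)
  compare : Trichotomous _≡_ _≺_
  compare x y with total x y
  ... | inj₁ refl         = tri≈ irr refl irr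
  ... | inj₂ (inj₁ x≺y) = tri< x≺y (λ { refl → irr x≺y }) (asym x≺y)
  ... | inj₂ (inj₂ y≺x) = tri> (asym y≺x) (λ { refl → irr y≺x }) y≺x

record UmbrellaOrder {n : ℕ} (G : Graph n) : Set₁ where
  field
    _≺_                : Rel (Fin n) 0ℓ
    isStrictTotalOrder : IsStrictTotalOrder _≡_ _≺_
    umbrella           : ∀ {x y z} → x ≺ y → y ≺ z → Adj G x z → Adj G x y ⊎ Adj G y z

  open IsStrictTotalOrder isStrictTotalOrder using (compare; asym)
    renaming (_<?_ to _≺?_; trans to ≺-trans)

  _⊑_ : Rel (Fin n) 0ℓ
  x ⊑ y = x ≡ y ⊎ (x ≺ y × ¬ Adj G x y)

  _⊑?_ : ∀ x y → Dec (x ⊑ y)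
  x ⊑? y = (x Fin.≟ y) ⊎-dec ((x ≺? y) ×-dec ¬? (adj G x y Bool.≟ true))

  poset : FinPoset n
  poset = record
    { le         = λ x y → does (x ⊑? y)
    ; le-refl    = λ x → dec-true (x ⊑? x) (inj₁ refl)
    ; le-antisym = λ x y p q → antisym (does⇒ (x ⊑? y) p) (does⇒ (y ⊑? x) q)
    ; le-trans   = λ x y z p q → dec-true (x ⊑? z) (⊑-trans (does⇒ (x ⊑? y) p) (does⇒ (y ⊑? z) q))
    }
    where
    antisym : ∀ {x y} → x ⊑ y → y ⊑ x → x ≡ y
    antisym (inj₁ x≡y)       _                = x≡y
    antisym (inj₂ _)         (inj₁ y≡x)       = sym y≡x
    antisym (inj₂ (x≺y , _)) (inj₂ (y≺x , _)) = contradiction y≺x (asym x≺y)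
    ⊑-trans : ∀ {x y z} → x ⊑ y → y ⊑ z → x ⊑ z
    ⊑-trans (inj₁ refl) y⊑z = y⊑z
    ⊑-trans (inj₂ x⊏y) (inj₁ refl) = inj₂ x⊏y
    ⊑-trans (inj₂ (x≺y , x≁y)) (inj₂ (y≺z , y≁z)) =
      inj₂ (≺-trans x≺y y≺z , λ x~z → [ x≁y , y≁z ] (umbrella x≺y y≺z x~z))

  le-poset : ∀ {x y} → le poset x y ≡ true ⇔ x ⊑ y
  le-poset {x} {y} = mk⇔ (does⇒ (x ⊑? y)) (dec-true (x ⊑? y))

  nonadjacent⇒comparable : ∀ {x y} → ¬ Adj G x y → Comparable poset x y
  nonadjacent⇒comparable {x} {y} x≁y = by-cases (compare x y)
    where
    by-cases : Tri (x ≺ y) (x ≡ y) (y ≺ x) → Comparable poset x y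
    by-cases (tri< x≺y _ _)  = inj₁ (⇐ le-poset (inj₂ (x≺y , x≁y)))
    by-cases (tri≈ _ refl _) = inj₁ (le-refl poset x)
    by-cases (tri> _ _ y≺x)  = inj₂ (⇐ le-poset (inj₂ (y≺x , x≁y ∘ adj-sym G y x)))

  incomparabilityGraph : IncomparabilityGraph G poset
  incomparabilityGraph x y = mk⇔ (λ x~y → above x~y , above (adj-sym G x y x~y)) below
    where
    above : ∀ {x y} → Adj G x y → le poset x y ≡ false
    above {x} {y} x~y = ¬-not λ x⊑y → [ (λ { refl → adj-irrefl G x~y }) , (λ p → proj₂ p x~y) ]
      (⇒ le-poset x⊑y)
    below : Incomparable poset x y → Adj G x y
    below inc = ¬-not λ x≁y → comparable⇒¬incomparable poset (nonadjacent⇒comparable (not-¬ x≁y)) inc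

umbrella-≅ : ∀ {n} {G : Graph n} (U V : UmbrellaOrder G) (θ : Fin n ↔ Fin n) →
  (∀ x y → UmbrellaOrder._≺_ U x y ⇔ UmbrellaOrder._≺_ V (to θ x) (to θ y)) →
  (∀ x y → Adj G x y ⇔ Adj G (to θ x) (to θ y)) →
  UmbrellaOrder.poset U ≅ UmbrellaOrder.poset V
umbrella-≅ {G = G} U V θ ≺⇔ ~⇔ = θ , λ x y → true⇔true⇒≡
  (⇐ (V.le-poset) ∘ forward ∘ ⇒ U.le-poset)
  (⇐ (U.le-poset) ∘ backward ∘ ⇒ V.le-poset)
  where
  module U = UmbrellaOrder U
  module V = UmbrellaOrder V
  forward : ∀ {x y} → U._⊑_ x y → V._⊑_ (to θ x) (to θ y)
  forward (inj₁ refl)       = inj₁ refl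
  forward (inj₂ (x≺y , x≁y)) = inj₂ (⇒ (≺⇔ _ _) x≺y , x≁y ∘ ⇐ (~⇔ _ _))
  backward : ∀ {x y} → V._⊑_ (to θ x) (to θ y) → U._⊑_ x y
  backward (inj₁ θx≡θy)        = inj₁ (Injection.injective (↔⇒↣ θ) θx≡θy)
  backward (inj₂ (θx≺θy , θx≁θy)) = inj₂ (⇐ (≺⇔ _ _) θx≺θy , θx≁θy ∘ ⇒ (~⇔ _ _))

count : ∀ {n} {P : Pred (Fin n) 0ℓ} → Decidable P → ℕ
count {zero}  P? = 0
count {suc n} P? with P? zero
... | yes _ = suc (count (P? ∘ suc))
... | no  _ = count (P? ∘ suc)

count-mono : ∀ {n} {P Q : Pred (Fin n) 0ℓ} (P? : Decidable P) (Q? : Decidable Q) →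
  P ⊆ Q → count P? ≤ count Q?
count-mono {zero}  P? Q? P⊆Q = z≤n
count-mono {suc n} P? Q? P⊆Q with P? zero | Q? zero
... | yes p | yes _ = s≤s (count-mono (P? ∘ suc) (Q? ∘ suc) P⊆Q)
... | yes p | no ¬q = contradiction (P⊆Q p) ¬q
... | no  _ | yes _ = m≤n⇒m≤1+n (count-mono (P? ∘ suc) (Q? ∘ suc) P⊆Q)
... | no  _ | no  _ = count-mono (P? ∘ suc) (Q? ∘ suc) P⊆Q

count-strict : ∀ {n} {P Q : Pred (Fin n) 0ℓ} (P? : Decidable P) (Q? : Decidable Q) →
  P ⊆ Q → ∀ {w} → Q w → ¬ P w → count P? < count Q?
count-strict {suc n} P? Q? P⊆Q {zero} q ¬p with P? zero | Q? zero
... | yes p | _     = contradiction p ¬p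
... | no  _ | yes _ = s≤s (count-mono (P? ∘ suc) (Q? ∘ suc) P⊆Q)
... | no  _ | no ¬q = contradiction q ¬q
count-strict {suc n} P? Q? P⊆Q {suc w} q ¬p with P? zero | Q? zero
... | yes p | yes _ = s≤s (count-strict (P? ∘ suc) (Q? ∘ suc) P⊆Q q ¬p)
... | yes p | no ¬q = contradiction (P⊆Q p) ¬q
... | no  _ | yes _ = m<n⇒m<1+n (count-strict (P? ∘ suc) (Q? ∘ suc) P⊆Q q ¬p)
... | no  _ | no  _ = count-strict (P? ∘ suc) (Q? ∘ suc) P⊆Q q ¬p

count-all : ∀ n → count {n} (λ _ → yes tt) ≡ n
count-all zero    = refl
count-all (suc n) = cong suc (count-all n)

count<n : ∀ {n} {P : Pred (Fin n) 0ℓ} (P? : Decidable P) {w} → ¬ P w → count P? < n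
count<n {n} P? ¬p = subst (count P? <_) (count-all n) (count-strict P? (λ _ → yes tt) _ tt ¬p)

injective⇒surjective : ∀ {n} (f : Fin n → Fin n) → Injective _≡_ _≡_ f → ∀ y → ∃ λ x → f x ≡ y
injective⇒surjective {zero}  f f-inj ()
injective⇒surjective {suc n} f f-inj y with any? (λ x → f x Fin.≟ y)
... | yes hit = hit
... | no miss = contradiction (injective⇒≤ {f = g} g-inj) 1+n≰n
  where
  fx≢y : ∀ x → y ≢ f x
  fx≢y x y≡fx = miss (x , sym y≡fx)
  g : Fin (suc n) → Fin n
  g x = punchOut (fx≢y x)
  g-inj : Injective _≡_ _≡_ g
  g-inj {x} {x'} e = f-inj (punchOut-injective (fx≢y x) (fx≢y x') e)

injective⇒↔ : ∀ {n} (f : Fin n → Fin n) → Injective _≡_ _≡_ f → Fin n ↔ Fin n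
injective⇒↔ f f-inj = mk↔ₛ′ f (proj₁ ∘ surj) (proj₂ ∘ surj) (λ x → f-inj (proj₂ (surj (f x))))
  where surj = injective⇒surjective f f-inj

record BlockOrder {n : ℕ} (blk : Fin n → ℕ) : Set₁ where
  field
    _≺_                : Rel (Fin n) 0ℓ
    isStrictTotalOrder : IsStrictTotalOrder _≡_ _≺_
    refines            : ∀ {x y} → blk x < blk y → x ≺ y

  open IsStrictTotalOrder isStrictTotalOrder using (compare; asym; irrefl)
    renaming (_<?_ to _≺?_; trans to ≺-trans)

  ≺⇒blk≤ : ∀ {x y} → x ≺ y → blk x ≤ blk y
  ≺⇒blk≤ x≺y = ≮⇒≥ (asym x≺y ∘ refines)

  rank : Fin n → ℕ
  rank x = count (_≺? x)

  rank-mono : ∀ {x y} → x ≺ y → rank x < rank y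
  rank-mono {x} {y} x≺y = count-strict (_≺? x) (_≺? y) (λ z≺x → ≺-trans z≺x x≺y) x≺y (irrefl refl)

  rank-reflects : ∀ {x y} → rank x < rank y → x ≺ y
  rank-reflects {x} {y} r< with compare x y
  ... | tri< x≺y _ _  = x≺y
  ... | tri≈ _ refl _ = contradiction r< (<-irrefl refl)
  ... | tri> _ _ y≺x  = contradiction (rank-mono y≺x) (<-asym r<)

  rank-injective : ∀ {x y} → rank x ≡ rank y → x ≡ y
  rank-injective {x} {y} r≡ with compare x y
  ... | tri< x≺y _ _ = contradiction (rank-mono x≺y) (<-irrefl r≡)
  ... | tri≈ _ x≡y _ = x≡y
  ... | tri> _ _ y≺x = contradiction (rank-mono y≺x) (<-irrefl (sym r≡))

  rankFin : Fin n → Fin n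
  rankFin x = fromℕ< (count<n (_≺? x) {x} (irrefl refl))

  toℕ-rankFin : ∀ x → toℕ (rankFin x) ≡ rank x
  toℕ-rankFin x = toℕ-fromℕ< _

  rankFin↔ : Fin n ↔ Fin n
  rankFin↔ = injective⇒↔ rankFin λ {x} {y} e →
    rank-injective (trans (sym (toℕ-rankFin x)) (trans (cong toℕ e) (toℕ-rankFin y)))

  lower-blocks≤rank : ∀ x → count (λ y → blk y <? blk x) ≤ rank x
  lower-blocks≤rank x = count-mono (λ y → blk y <? blk x) (_≺? x) refines

  rank<blocks-upto : ∀ x → rank x < count (λ y → blk y ≤? blk x)
  rank<blocks-upto x = count-strict (_≺? x) (λ y → blk y ≤? blk x) ≺⇒blk≤ ≤-refl (irrefl refl)

-- θ matches elements of equal rank; as both orders sort by block first, a rank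
-- determines the block.
blockOrder-iso : ∀ {n} {blk : Fin n → ℕ} (O₁ O₂ : BlockOrder blk) →
  Σ (Fin n ↔ Fin n) λ θ → (∀ x → blk (to θ x) ≡ blk x)
                        × (∀ x y → BlockOrder._≺_ O₁ x y ⇔ BlockOrder._≺_ O₂ (to θ x) (to θ y))
blockOrder-iso {n} {blk} O₁ O₂ = θ , θ-blk , λ x y → mk⇔
  (λ x≺y → O₂.rank-reflects (subst₂ _<_ (sym (rank-θ x)) (sym (rank-θ y)) (O₁.rank-mono x≺y)))
  (λ θx≺θy → O₁.rank-reflects (subst₂ _<_ (rank-θ x) (rank-θ y) (O₂.rank-mono θx≺θy)))
  where
  module O₁ = BlockOrder O₁
  module O₂ = BlockOrder O₂
  θ : Fin n ↔ Fin n
  θ = ↔-trans O₁.rankFin↔ (↔-sym O₂.rankFin↔)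
  rank-θ : ∀ x → O₂.rank (to θ x) ≡ O₁.rank x
  rank-θ x = begin
    O₂.rank (to θ x)          ≡⟨ sym (O₂.toℕ-rankFin (to θ x)) ⟩
    toℕ (O₂.rankFin (to θ x)) ≡⟨ cong toℕ (strictlyInverseˡ O₂.rankFin↔ (O₁.rankFin x)) ⟩
    toℕ (O₁.rankFin x)        ≡⟨ O₁.toℕ-rankFin x ⟩
    O₁.rank x                 ∎
    where open ≡-Reasoning
  blocks-upto≤blocks-below : ∀ {b b'} → b < b' →
    count (λ y → blk y ≤? b) ≤ count (λ y → blk y <? b')
  blocks-upto≤blocks-below b<b' =
    count-mono (λ y → blk y ≤? _) (λ y → blk y <? _) (λ p → ≤-<-trans p b<b')
  θ-blk : ∀ x → blk (to θ x) ≡ blk x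
  θ-blk x with <-cmp (blk (to θ x)) (blk x)
  ... | tri≈ _ e _ = e
  ... | tri< b< _ _ = contradiction (begin-strict
        count (λ y → blk y ≤? blk (to θ x)) ≤⟨ blocks-upto≤blocks-below b< ⟩
        count (λ y → blk y <? blk x)        ≤⟨ O₁.lower-blocks≤rank x ⟩
        O₁.rank x                           ≡⟨ sym (rank-θ x) ⟩
        O₂.rank (to θ x)                    <⟨ O₂.rank<blocks-upto (to θ x) ⟩
        count (λ y → blk y ≤? blk (to θ x)) ∎) (<-irrefl refl)
    where open ≤-Reasoning
  ... | tri> _ _ b> = contradiction (begin-strict
        count (λ y → blk y ≤? blk x)        ≤⟨ blocks-upto≤blocks-below b> ⟩
        count (λ y → blk y <? blk (to θ x)) ≤⟨ O₂.lower-blocks≤rank (to θ x) ⟩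
        O₂.rank (to θ x)                    ≡⟨ rank-θ x ⟩
        O₁.rank x                           <⟨ O₁.rank<blocks-upto x ⟩
        count (λ y → blk y ≤? blk x)        ∎) (<-irrefl refl)
    where open ≤-Reasoning

-- The caterpillar on blocks

double : ℕ → ℕ
double zero    = zero
double (suc i) = suc (suc (double i))

double-injective : ∀ {i j} → double i ≡ double j → i ≡ j
double-injective {zero}  {zero}  _ = refl
double-injective {suc i} {suc j} e = cong suc (double-injective (suc-injective (suc-injective e)))

double≢odd : ∀ {i j} → double i ≢ suc (double j)
double≢odd {suc i} {suc j} e = double≢odd {i} {j} (suc-injective (suc-injective e))

parity : ∀ b → (∃ λ i → b ≡ double i) ⊎ (∃ λ i → b ≡ suc (double i))
parity zero          = inj₁ (0 , refl)
parity (suc zero)    = inj₂ (0 , refl)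
parity (suc (suc b)) with parity b
... | inj₁ (i , e) = inj₁ (suc i , cong (λ k → suc (suc k)) e)
... | inj₂ (i , e) = inj₂ (suc i , cong (λ k → suc (suc k)) e)

double-cancel-< : ∀ {i j} → double i < double j → i < j
double-cancel-< {zero}  {suc j} _                 = s≤s z≤n
double-cancel-< {suc i} {suc j} (s≤s (s≤s d<d)) = s≤s (double-cancel-< d<d)

double-cancel-≤ : ∀ {i j} → double i ≤ double j → i ≤ j
double-cancel-≤ {zero}                _                 = z≤n
double-cancel-≤ {suc i} {suc j} (s≤s (s≤s d≤d)) = s≤s (double-cancel-≤ d≤d)

double-mono-≤ : ∀ {i j} → i ≤ j → double i ≤ double j
double-mono-≤ z≤n       = z≤n
double-mono-≤ (s≤s i≤j) = s≤s (s≤s (double-mono-≤ i≤j))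

double≤odd⇒≤ : ∀ {i j} → double i ≤ suc (double j) → i ≤ j
double≤odd⇒≤ d≤ = ≮⇒≥ λ j<i → 1+n≰n (≤-trans (double-mono-≤ j<i) d≤)

-- Spine block 2m is joined to its leaf block 2m+1 and to the next spine block 2m+2.
Link : ℕ → ℕ → Set
Link a b = ∃ λ m → a ≡ double m × (b ≡ suc a ⊎ b ≡ suc (suc a))

BlockAdj : ℕ → ℕ → Set
BlockAdj a b = Link a b ⊎ Link b a

BlockAdj-sym : ∀ {a b} → BlockAdj a b → BlockAdj b a
BlockAdj-sym (inj₁ l) = inj₂ l
BlockAdj-sym (inj₂ l) = inj₁ l

Link⇒< : ∀ {a b} → Link a b → a < b
Link⇒< (_ , _ , inj₁ refl) = ≤-refl
Link⇒< (_ , _ , inj₂ refl) = n≤1+n _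

BlockAdj-irrefl : ∀ {a} → ¬ BlockAdj a a
BlockAdj-irrefl (inj₁ l) = <-irrefl refl (Link⇒< l)
BlockAdj-irrefl (inj₂ l) = <-irrefl refl (Link⇒< l)

spine-next : ∀ i → BlockAdj (double i) (double (suc i))
spine-next i = inj₁ (i , refl , inj₂ refl)

spine-leaf : ∀ i → BlockAdj (double i) (suc (double i))
spine-leaf i = inj₁ (i , refl , inj₁ refl)

spine-spine : ∀ {i j} → BlockAdj (double i) (double j) → j ≡ suc i ⊎ i ≡ suc j
spine-spine {i} {j} (inj₁ (_ , _ , inj₁ e)) = contradiction e (double≢odd {j} {i})
spine-spine {i} {j} (inj₁ (_ , _ , inj₂ e)) = inj₁ (double-injective {j} {suc i} e)
spine-spine {i} {j} (inj₂ (_ , _ , inj₁ e)) = contradiction e (double≢odd {i} {j})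
spine-spine {i} {j} (inj₂ (_ , _ , inj₂ e)) = inj₂ (double-injective {i} {suc j} e)

spine-leaf⁻¹ : ∀ {i j} → BlockAdj (double i) (suc (double j)) → i ≡ j
spine-leaf⁻¹ {i} {j} (inj₁ (_ , _ , inj₁ e)) = sym (double-injective (suc-injective e))
spine-leaf⁻¹ {i} {j} (inj₁ (_ , _ , inj₂ e)) = contradiction (suc-injective e) (double≢odd {j} {i})
spine-leaf⁻¹ {i} {j} (inj₂ (m , e , _))      = contradiction (sym e) (double≢odd {m} {j})

leaf-spine⁻¹ : ∀ {i j} → BlockAdj (suc (double i)) (double j) → i ≡ j
leaf-spine⁻¹ a = sym (spine-leaf⁻¹ (BlockAdj-sym a))

leaf-leaf : ∀ {i j} → ¬ BlockAdj (suc (double i)) (suc (double j))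
leaf-leaf {i} {j} (inj₁ (m , e , _)) = double≢odd {m} {i} (sym e)
leaf-leaf {i} {j} (inj₂ (m , e , _)) = double≢odd {m} {j} (sym e)

spine-spine-far : ∀ {i j} → suc i < j → ¬ BlockAdj (double i) (double j)
spine-spine-far i+1<j a with spine-spine a
... | inj₁ refl = <-irrefl refl i+1<j
... | inj₂ refl = <-asym i+1<j (s≤s (n≤1+n _))

spine-leaf-far : ∀ {i j} → i ≢ j → ¬ BlockAdj (double i) (suc (double j))
spine-leaf-far i≢j a = i≢j (spine-leaf⁻¹ a)

leaf-spine-far : ∀ {i j} → i ≢ j → ¬ BlockAdj (suc (double i)) (double j)
leaf-spine-far i≢j a = i≢j (leaf-spine⁻¹ a)

between₁ : ∀ {a b} → a ≤ b → b ≤ suc a → b ≡ a ⊎ b ≡ suc a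
between₁ a≤b b≤1+a with m≤n⇒m<n∨m≡n b≤1+a
... | inj₁ b<1+a = inj₁ (≤-antisym (≤-pred b<1+a) a≤b)
... | inj₂ b≡1+a = inj₂ b≡1+a

between₂ : ∀ {a b} → a ≤ b → b ≤ suc (suc a) → b ≡ a ⊎ b ≡ suc a ⊎ b ≡ suc (suc a)
between₂ a≤b b≤2+a with m≤n⇒m<n∨m≡n b≤2+a
... | inj₁ b<2+a = Data.Sum.map₂ inj₁ (between₁ a≤b (≤-pred b<2+a))
... | inj₂ b≡2+a = inj₂ (inj₂ b≡2+a)

BlockAdj-umbrella : ∀ {a b c} → a ≤ b → b ≤ c → BlockAdj a c → BlockAdj a b ⊎ BlockAdj b c
BlockAdj-umbrella a≤b b≤c (inj₂ l) = contradiction (≤-trans a≤b b≤c) (<⇒≱ (Link⇒< l))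
BlockAdj-umbrella a≤b b≤c (inj₁ (m , a≡ , inj₁ refl)) with between₁ a≤b b≤c
... | inj₁ refl = inj₂ (inj₁ (m , a≡ , inj₁ refl))
... | inj₂ refl = inj₁ (inj₁ (m , a≡ , inj₁ refl))
BlockAdj-umbrella a≤b b≤c (inj₁ (m , a≡ , inj₂ refl)) with between₂ a≤b b≤c
... | inj₁ refl        = inj₂ (inj₁ (m , a≡ , inj₂ refl))
... | inj₂ (inj₁ refl) = inj₁ (inj₁ (m , a≡ , inj₁ refl))
... | inj₂ (inj₂ refl) = inj₁ (inj₁ (m , a≡ , inj₂ refl))

blockColour : ℕ → Bool
blockColour zero          = false
blockColour (suc zero)    = true
blockColour (suc (suc b)) = not (blockColour b)

blockColour-leaf : ∀ m → blockColour (suc (double m)) ≡ not (blockColour (double m))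
blockColour-leaf zero    = refl
blockColour-leaf (suc m) = cong not (blockColour-leaf m)

blockColour-proper : ∀ {a b} → BlockAdj a b → blockColour a ≢ blockColour b
blockColour-proper (inj₁ l)   = link-proper l
  where
  link-proper : ∀ {a b} → Link a b → blockColour a ≢ blockColour b
  link-proper (m , refl , inj₁ refl) e = not-¬ refl (trans e (blockColour-leaf m))
  link-proper (m , refl , inj₂ refl) e = not-¬ refl e
blockColour-proper (inj₂ l) e = blockColour-proper (inj₁ l) (sym e)

record CaterpillarLayout {n : ℕ} (G : Graph n) : Set where
  field
    block        : Fin n → ℕ
    top          : ℕ
    adj⇔         : ∀ x y → Adj G x y ⇔ BlockAdj (block x) (block y)
    spine-unique : ∀ {x y i} → block x ≡ double i → block y ≡ double i → x ≡ y
    block<       : ∀ x → block x < double (suc top)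
    spine        : ∀ i → i ≤ top → ∃ λ x → block x ≡ double i
    first-leaf   : 1 ≤ top → ∃ λ x → block x ≡ 1
    last-leaf    : 1 ≤ top → ∃ λ x → block x ≡ suc (double top)

module Layout {n : ℕ} {G : Graph n} (L : CaterpillarLayout G) where
  open CaterpillarLayout L

  adjacent : ∀ {x y} → BlockAdj (block x) (block y) → Adj G x y
  adjacent = ⇐ (adj⇔ _ _)

  blockUmbrella : BlockOrder block → UmbrellaOrder G
  blockUmbrella O = record
    { _≺_                = _≺_
    ; isStrictTotalOrder = isStrictTotalOrder
    ; umbrella           = λ x≺y y≺z x~z → Data.Sum.map adjacent adjacent
        (BlockAdj-umbrella (≺⇒blk≤ x≺y) (≺⇒blk≤ y≺z) (⇒ (adj⇔ _ _) x~z))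
    }
    where open BlockOrder O

  _<ₗₑₓ_ : Rel (Fin n) 0ℓ
  x <ₗₑₓ y = block x < block y ⊎ (block x ≡ block y × x Fin.< y)

  lexOrder : BlockOrder block
  lexOrder = record
    { _≺_                = _<ₗₑₓ_
    ; isStrictTotalOrder = isStrictTotalOrder-≡ irrefl lex-trans total
    ; refines            = inj₁
    }
    where
    irrefl : ∀ {x} → ¬ x <ₗₑₓ x
    irrefl (inj₁ b<b)       = <-irrefl refl b<b
    irrefl (inj₂ (_ , x<x)) = <-irrefl refl x<x
    lex-trans : Transitive _<ₗₑₓ_
    lex-trans     (inj₁ p)       (inj₁ q)        = inj₁ (<-trans p q)
    lex-trans {x} (inj₁ p)       (inj₂ (e , _))  = inj₁ (subst (block x <_) e p)
    lex-trans {k = z} (inj₂ (e , _)) (inj₁ q)    = inj₁ (subst (_< block z) (sym e) q)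
    lex-trans     (inj₂ (e , p)) (inj₂ (e' , q)) = inj₂ (trans e e' , Data.Fin.Properties.<-trans p q)
    total : ∀ x y → x ≡ y ⊎ x <ₗₑₓ y ⊎ y <ₗₑₓ x
    total x y with <-cmp (block x) (block y) | Data.Fin.Properties.<-cmp x y
    ... | tri< b< _ _ | _           = inj₂ (inj₁ (inj₁ b<))
    ... | tri> _ _ b> | _           = inj₂ (inj₂ (inj₁ b>))
    ... | tri≈ _ b≡ _ | tri< x<y _ _ = inj₂ (inj₁ (inj₂ (b≡ , x<y)))
    ... | tri≈ _ _ _  | tri≈ _ x≡y _ = inj₁ x≡y
    ... | tri≈ _ b≡ _ | tri> _ _ y<x = inj₂ (inj₂ (inj₂ (sym b≡ , y<x)))

  canonical : FinPoset n
  canonical = UmbrellaOrder.poset (blockUmbrella lexOrder)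

  canonical-incomparabilityGraph : IncomparabilityGraph G canonical
  canonical-incomparabilityGraph = UmbrellaOrder.incomparabilityGraph (blockUmbrella lexOrder)

  colour : Fin n → Bool
  colour = blockColour ∘ block

  colour-cover : TwoChainCover canonical colour
  colour-cover x y same = UmbrellaOrder.nonadjacent⇒comparable (blockUmbrella lexOrder)
    λ x~y → blockColour-proper (⇒ (adj⇔ x y) x~y) same

  leaf-neighbour : ∀ {u w y m} → block u ≡ double m → block w ≡ suc (double m) → Adj G w y → y ≡ u
  leaf-neighbour {y = y} bu bw w~y with parity (block y)
  ... | inj₁ (j , by) = spine-unique (trans by (cong double (sym (leaf-spine⁻¹ w~y′)))) bu
    where w~y′ = subst₂ BlockAdj bw by (⇒ (adj⇔ _ _) w~y)
  ... | inj₂ (j , by) = contradiction (subst₂ BlockAdj bw by (⇒ (adj⇔ _ _) w~y)) leaf-leaf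

  crossing-spine-edge : ∀ {a b m} → a ≤ suc (double m) → suc (double m) < b → BlockAdj a b →
    a ≡ double m × b ≡ double (suc m)
  crossing-spine-edge a≤ <b (inj₂ l) = contradiction (Link⇒< l) (<-asym (≤-<-trans a≤ <b))
  crossing-spine-edge {m = m} a≤ <b (inj₁ (m' , refl , inj₁ refl)) =
    contradiction (≤-antisym a≤ (≤-pred <b)) (double≢odd {m'} {m})
  crossing-spine-edge {m = m} a≤ <b (inj₁ (m' , refl , inj₂ refl))
    with ≤-antisym (double≤odd⇒≤ a≤) (double-cancel-≤ (≤-pred (≤-pred <b)))
  ... | refl = refl , refl

  spine-bridgeCut : ∀ {u w m} → block u ≡ double m → block w ≡ double (suc m) →
    BridgeCut G u w (λ x → does (block x ≤? suc (double m)))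
  spine-bridgeCut {u} {w} {m} bu bw = Su≢Sw , crossing
    where
    left? : ∀ x → Dec (block x ≤ suc (double m))
    left? x = block x ≤? suc (double m)
    Su≢Sw : does (left? u) ≢ does (left? w)
    Su≢Sw e = not-¬ (dec-false (left? w) (1+n≰n ∘ subst (_≤ suc (double m)) bw))
      (trans (sym e) (dec-true (left? u) (subst (_≤ suc (double m)) (sym bu) (n≤1+n _))))
    across : ∀ {x y} → Adj G x y → block x ≤ suc (double m) → ¬ block y ≤ suc (double m) →
      x ≡ u × y ≡ w
    across x~y x-left y-right with crossing-spine-edge x-left (≰⇒> y-right) (⇒ (adj⇔ _ _) x~y)
    ... | bx , by = spine-unique bx bu , spine-unique by bw
    crossing : ∀ {x y} → Adj G x y → does (left? x) ≢ does (left? y) →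
      (x ≡ u × y ≡ w) ⊎ (x ≡ w × y ≡ u)
    crossing {x} {y} x~y Sx≢Sy with left? x | left? y
    ... | yes x-left | no y-right = inj₁ (across x~y x-left y-right)
    ... | no x-right | yes y-left = inj₂ (swap (across (adj-sym G x y x~y) y-left x-right))
    ... | yes x-left | yes y-left =
      contradiction (trans (dec-true (left? x) x-left) (sym (dec-true (left? y) y-left))) Sx≢Sy
    ... | no x-right | no y-right =
      contradiction (trans (dec-false (left? x) x-right) (sym (dec-false (left? y) y-right))) Sx≢Sy

  link-bridgeCut : ∀ {u w} → Link (block u) (block w) → ∃ (BridgeCut G u w)
  link-bridgeCut (m , bu , inj₁ bw) = _ , leaf-bridgeCut G (adjacent (inj₁ (m , bu , inj₁ bw)))
    (leaf-neighbour bu (trans bw (cong suc bu)))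
  link-bridgeCut (m , bu , inj₂ bw) = _ , spine-bridgeCut bu (trans bw (cong (λ k → suc (suc k)) bu))

  bridgeCut : ∀ {i j} → Adj G i j → ∃ (BridgeCut G i j)
  bridgeCut {i} {j} i~j with ⇒ (adj⇔ i j) i~j
  ... | inj₁ l = link-bridgeCut l
  ... | inj₂ l = map₂ (BridgeCut-sym {G = G} {i = j} {j = i}) (link-bridgeCut l)

  canonical-isTwoChain : Connected G → IsTwoChain canonical
  canonical-isTwoChain conn =
    two-chain-criterion {P = canonical} canonical-incomparabilityGraph conn colour-cover bridgeCut

  spine≤top : ∀ {x i} → block x ≡ double i → i ≤ top
  spine≤top {x} bx = ≤-pred (double-cancel-< (subst (_< _) bx (block< x)))

  leaf≤top : ∀ {x i} → block x ≡ suc (double i) → i ≤ top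
  leaf≤top {x} bx = ≤-pred (double-cancel-< (<-trans (n<1+n _) (subst (_< _) bx (block< x))))

  spine-vertex : ∀ {i} → i ≤ top → Fin n
  spine-vertex i≤top = proj₁ (spine _ i≤top)

  spine-vertex-block : ∀ {i} (i≤top : i ≤ top) → block (spine-vertex i≤top) ≡ double i
  spine-vertex-block i≤top = proj₂ (spine _ i≤top)

  Forward : FinPoset n → Set
  Forward R = ∀ x y → block x < block y → ¬ Adj G x y → le R x y ≡ true

  module Orientation (R : FinPoset n) (incR : IncomparabilityGraph G R) where

    comparable : ∀ {x y} → ¬ BlockAdj (block x) (block y) → Comparable R x y
    comparable {x} {y} x≁y with comparable-or-incomparable R x y
    ... | inj₁ cmp = cmp
    ... | inj₂ inc = contradiction (⇒ (adj⇔ x y) (⇐ (incR x y) inc)) x≁y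

    moveʳ : ∀ {x y z a b c} → block x ≡ a → block y ≡ b → block z ≡ c →
      ¬ BlockAdj a b → ¬ BlockAdj a c → BlockAdj b c → le R x y ≡ le R x z
    moveʳ refl refl refl a≁b a≁c b~c =
      le-forcedʳ R (comparable a≁b) (comparable a≁c) (⇒ (incR _ _) (adjacent b~c))

    moveˡ : ∀ {x y z a b c} → block x ≡ a → block y ≡ b → block z ≡ c →
      ¬ BlockAdj a b → ¬ BlockAdj c b → BlockAdj a c → le R x y ≡ le R z y
    moveˡ refl refl refl a≁b c≁b a~c =
      le-forcedˡ R (comparable a≁b) (comparable c≁b) (⇒ (incR _ _) (adjacent a~c))

    -- Chains of forcing steps give every comparable pair with increasing blocks the
    -- orientation of the pair (α, σ) in blocks 1 and 2.
    module Anchored (1≤top : 1 ≤ top) where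

      α : Fin n
      α = proj₁ (first-leaf 1≤top)

      α-block : block α ≡ 1
      α-block = proj₂ (first-leaf 1≤top)

      σ : Fin n
      σ = spine-vertex 1≤top

      D : Bool
      D = le R α σ

      spine₀-to-spine : ∀ j {x y} → block x ≡ 0 → block y ≡ double j → 2 ≤ j → le R x y ≡ D
      spine₀-to-spine zero             _  _  ()
      spine₀-to-spine (suc zero)       _  _  (s≤s ())
      spine₀-to-spine (suc (suc zero)) bx by _ = begin
        le R _ _ ≡⟨ moveˡ bx by α-block
                      (spine-spine-far {0} ≤-refl) (leaf-spine-far {0} λ ()) (spine-leaf 0) ⟩
        le R α _ ≡⟨ moveʳ α-block by (spine-vertex-block 1≤top)
                      (leaf-spine-far {0} λ ()) (leaf-spine-far {0} λ ()) (BlockAdj-sym (spine-next 1)) ⟩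
        D        ∎
        where open ≡-Reasoning
      spine₀-to-spine (suc (suc (suc j))) bx by _ = begin
        le R _ _  ≡⟨ moveʳ bx by by′
                       (spine-spine-far {0} (s≤s (s≤s z≤n))) (spine-spine-far {0} (s≤s (s≤s z≤n)))
                       (BlockAdj-sym (spine-next (suc (suc j)))) ⟩
        le R _ y′ ≡⟨ spine₀-to-spine (suc (suc j)) bx by′ (s≤s (s≤s z≤n)) ⟩
        D         ∎
        where
        open ≡-Reasoning
        j+2≤top = ≤-trans (n≤1+n _) (spine≤top by)
        y′ = spine-vertex j+2≤top
        by′ = spine-vertex-block j+2≤top

      spine-to-spine : ∀ i j {x y} → block x ≡ double i → block y ≡ double j → suc (suc i) ≤ j →
        le R x y ≡ D
      spine-to-spine zero    j bx by i+2≤j = spine₀-to-spine j bx by i+2≤j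
      spine-to-spine (suc i) j bx by i+2≤j = begin
        le R _ _  ≡⟨ moveˡ bx by bx′ (spine-spine-far i+2≤j) (spine-spine-far i+1<j)
                       (BlockAdj-sym (spine-next i)) ⟩
        le R x′ _ ≡⟨ spine-to-spine i j bx′ by i+1<j ⟩
        D         ∎
        where
        open ≡-Reasoning
        i+1<j = ≤-trans (n≤1+n _) i+2≤j
        i≤top = ≤-trans (n≤1+n _) (spine≤top bx)
        x′ = spine-vertex i≤top
        bx′ = spine-vertex-block i≤top

      spine-to-far-leaf : ∀ i j {x y} → block x ≡ double i → block y ≡ suc (double j) → suc i < j →
        le R x y ≡ D
      spine-to-far-leaf i j bx by i+1<j = begin
        le R _ _  ≡⟨ moveʳ bx by by′ (spine-leaf-far (<⇒≢ (<-trans (n<1+n _) i+1<j)))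
                       (spine-spine-far i+1<j) (BlockAdj-sym (spine-leaf j)) ⟩
        le R _ y′ ≡⟨ spine-to-spine i j bx by′ i+1<j ⟩
        D         ∎
        where
        open ≡-Reasoning
        j≤top = leaf≤top by
        y′ = spine-vertex j≤top
        by′ = spine-vertex-block j≤top

      spine-to-leaf : ∀ i j {x y} → block x ≡ double i → block y ≡ suc (double j) → i < j →
        le R x y ≡ D
      spine-to-leaf i j bx by i<j with m≤n⇒m<n∨m≡n i<j
      ... | inj₁ i+1<j = spine-to-far-leaf i j bx by i+1<j
      spine-to-leaf zero .1 bx by _ | inj₂ refl = begin
        le R _ _ ≡⟨ moveˡ bx by α-block (spine-leaf-far {0} λ ()) leaf-leaf (spine-leaf 0) ⟩
        le R α _ ≡⟨ moveʳ α-block by (spine-vertex-block 1≤top)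
                      leaf-leaf (leaf-spine-far {0} λ ()) (BlockAdj-sym (spine-leaf 1)) ⟩
        D        ∎
        where open ≡-Reasoning
      spine-to-leaf (suc i) .(suc (suc i)) bx by _ | inj₂ refl = begin
        le R _ _  ≡⟨ moveˡ bx by bx′ (spine-leaf-far λ ()) (spine-leaf-far λ ())
                       (BlockAdj-sym (spine-next i)) ⟩
        le R x′ _ ≡⟨ spine-to-far-leaf i (suc (suc i)) bx′ by ≤-refl ⟩
        D         ∎
        where
        open ≡-Reasoning
        i≤top = ≤-trans (n≤1+n _) (spine≤top bx)
        x′ = spine-vertex i≤top
        bx′ = spine-vertex-block i≤top

      leaf-to-leaf : ∀ i j {x y} → block x ≡ suc (double i) → block y ≡ suc (double j) → i < j →
        le R x y ≡ D
      leaf-to-leaf i j bx by i<j = begin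
        le R _ _  ≡⟨ moveˡ bx by bx′ leaf-leaf (spine-leaf-far (<⇒≢ i<j)) (BlockAdj-sym (spine-leaf i)) ⟩
        le R x′ _ ≡⟨ spine-to-leaf i j bx′ by i<j ⟩
        D         ∎
        where
        open ≡-Reasoning
        i≤top = leaf≤top bx
        x′ = spine-vertex i≤top
        bx′ = spine-vertex-block i≤top

      leaf-to-far-spine : ∀ i j {x y} → block x ≡ suc (double i) → block y ≡ double j → suc i < j →
        le R x y ≡ D
      leaf-to-far-spine i j bx by i+1<j = begin
        le R _ _  ≡⟨ moveˡ bx by bx′ (leaf-spine-far (<⇒≢ (<-trans (n<1+n _) i+1<j)))
                       (spine-spine-far i+1<j) (BlockAdj-sym (spine-leaf i)) ⟩
        le R x′ _ ≡⟨ spine-to-spine i j bx′ by i+1<j ⟩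
        D         ∎
        where
        open ≡-Reasoning
        i≤top = leaf≤top bx
        x′ = spine-vertex i≤top
        bx′ = spine-vertex-block i≤top

      leaf-to-spine : ∀ i j {x y} → block x ≡ suc (double i) → block y ≡ double j → i < j →
        le R x y ≡ D
      leaf-to-spine i j bx by i<j with m≤n⇒m<n∨m≡n i<j
      ... | inj₁ i+1<j = leaf-to-far-spine i j bx by i+1<j
      ... | inj₂ refl with suc (suc i) ≤? top
      ...   | yes i+2≤top = begin
        le R _ _  ≡⟨ moveʳ bx by by′ (leaf-spine-far λ ()) (leaf-spine-far λ ()) (spine-next (suc i)) ⟩
        le R _ y′ ≡⟨ leaf-to-far-spine i (suc (suc i)) bx by′ ≤-refl ⟩
        D         ∎
        where
        open ≡-Reasoning
        y′ = spine-vertex i+2≤top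
        by′ = spine-vertex-block i+2≤top
      ...   | no i+2≰top = begin
        le R _ _  ≡⟨ moveʳ bx by bz (leaf-spine-far λ ()) leaf-leaf (spine-leaf (suc i)) ⟩
        le R _ z  ≡⟨ leaf-to-leaf i (suc i) bx bz ≤-refl ⟩
        D         ∎
        where
        open ≡-Reasoning
        top≡i+1 : top ≡ suc i
        top≡i+1 = ≤-antisym (≮⇒≥ i+2≰top) (spine≤top by)
        z = proj₁ (last-leaf 1≤top)
        bz : block z ≡ suc (double (suc i))
        bz = trans (proj₂ (last-leaf 1≤top)) (cong (suc ∘ double) top≡i+1)

      oriented : ∀ {x y} → block x < block y → ¬ BlockAdj (block x) (block y) → le R x y ≡ D
      oriented {x} {y} bx<by x≁y with parity (block x) | parity (block y)
      ... | inj₁ (i , bx) | inj₁ (j , by) = spine-to-spine i j bx by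
        (≤∧≢⇒< (double-cancel-< (subst₂ _<_ bx by bx<by))
               λ { refl → x≁y (subst₂ BlockAdj (sym bx) (sym by) (spine-next i)) })
      ... | inj₁ (i , bx) | inj₂ (j , by) = spine-to-leaf i j bx by
        (≤∧≢⇒< (double-cancel-≤ (≤-pred (subst₂ _<_ bx by bx<by)))
               λ { refl → x≁y (subst₂ BlockAdj (sym bx) (sym by) (spine-leaf i)) })
      ... | inj₂ (i , bx) | inj₁ (j , by) =
        leaf-to-spine i j bx by (double-cancel-< (<-trans (n<1+n _) (subst₂ _<_ bx by bx<by)))
      ... | inj₂ (i , bx) | inj₂ (j , by) =
        leaf-to-leaf i j bx by (double-cancel-< (≤-pred (subst₂ _<_ bx by bx<by)))

    orientation : Forward R ⊎ Forward (dual R)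
    orientation with 1 ≤? top
    ... | no 1≰top = inj₁ λ x y bx<by x≁y → contradiction (adjacent (first-blocks bx<by (block<2 y))) x≁y
      where
      block<2 : ∀ y → block y < double 1
      block<2 y = subst (λ t → block y < double (suc t)) (n≤0⇒n≡0 (≤-pred (≰⇒> 1≰top))) (block< y)
      first-blocks : ∀ {a b} → a < b → b < double 1 → BlockAdj a b
      first-blocks {zero} {suc zero} _ _ = spine-leaf 0
      first-blocks {_} {suc (suc _)} _ (s≤s (s≤s ()))
      first-blocks {suc _} {suc zero} (s≤s ()) _
    ... | yes 1≤top with Anchored.D 1≤top in d
    ...   | true  = inj₁ λ x y bx<by x≁y → trans (Anchored.oriented 1≤top bx<by (x≁y ∘ adjacent)) d
    ...   | false = inj₂ λ x y bx<by x≁y → reverse (comparable (x≁y ∘ adjacent))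
                                   (trans (Anchored.oriented 1≤top bx<by (x≁y ∘ adjacent)) d)
      where
      reverse : ∀ {x y} → Comparable R x y → le R x y ≡ false → le R y x ≡ true
      reverse (inj₁ x≤y) x≰y = contradiction x≤y (not-¬ x≰y)
      reverse (inj₂ y≤x) _   = y≤x

  module _ (R : FinPoset n) (incR : IncomparabilityGraph G R) (fwd : Forward R) where
    open Orientation R incR using (comparable)

    private
      same-block-comparable : ∀ {x y} → block x ≡ block y → Comparable R x y
      same-block-comparable {y = y} b≡ =
        comparable λ a → BlockAdj-irrefl (subst (λ b → BlockAdj b (block y)) b≡ a)

    _≺ᴿ_ : Rel (Fin n) 0ℓ
    x ≺ᴿ y = block x < block y ⊎ (block x ≡ block y × x ≢ y × le R x y ≡ true)

    forwardOrder : BlockOrder block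
    forwardOrder = record
      { _≺_                = _≺ᴿ_
      ; isStrictTotalOrder = isStrictTotalOrder-≡ irrefl ≺ᴿ-trans total
      ; refines            = inj₁
      }
      where
      irrefl : ∀ {x} → ¬ x ≺ᴿ x
      irrefl (inj₁ b<b)           = <-irrefl refl b<b
      irrefl (inj₂ (_ , x≢x , _)) = x≢x refl
      ≺ᴿ-trans : Transitive _≺ᴿ_
      ≺ᴿ-trans     (inj₁ p)       (inj₁ q)              = inj₁ (<-trans p q)
      ≺ᴿ-trans {x} (inj₁ p)       (inj₂ (e , _))        = inj₁ (subst (block x <_) e p)
      ≺ᴿ-trans {k = z} (inj₂ (e , _)) (inj₁ q)          = inj₁ (subst (_< block z) (sym e) q)
      ≺ᴿ-trans {x} {y} {z} (inj₂ (e , x≢y , x≤y)) (inj₂ (e' , _ , y≤z)) =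
        inj₂ (trans e e' , (λ { refl → x≢y (le-antisym R x y x≤y y≤z) }) , le-trans R x y z x≤y y≤z)
      total : ∀ x y → x ≡ y ⊎ x ≺ᴿ y ⊎ y ≺ᴿ x
      total x y with <-cmp (block x) (block y) | x Fin.≟ y
      ... | tri< b< _ _ | _        = inj₂ (inj₁ (inj₁ b<))
      ... | tri> _ _ b> | _        = inj₂ (inj₂ (inj₁ b>))
      ... | tri≈ _ _ _  | yes x≡y = inj₁ x≡y
      ... | tri≈ _ b≡ _ | no x≢y with same-block-comparable b≡
      ...   | inj₁ x≤y = inj₂ (inj₁ (inj₂ (b≡ , x≢y , x≤y)))
      ...   | inj₂ y≤x = inj₂ (inj₂ (inj₂ (sym b≡ , x≢y ∘ sym , y≤x)))

    private
      module F = UmbrellaOrder (blockUmbrella forwardOrder)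

    le≡forward : ∀ x y → le R x y ≡ le F.poset x y
    le≡forward x y = true⇔true⇒≡ (⇐ F.le-poset ∘ to-⊑) (from-⊑ ∘ ⇒ F.le-poset)
      where
      to-⊑ : le R x y ≡ true → F._⊑_ x y
      to-⊑ x≤y with x Fin.≟ y
      ... | yes x≡y = inj₁ x≡y
      ... | no x≢y  = inj₂ (order , x≁y)
        where
        x≁y : ¬ Adj G x y
        x≁y x~y = not-¬ (proj₁ (⇒ (incR x y) x~y)) x≤y
        order : x ≺ᴿ y
        order with <-cmp (block x) (block y)
        ... | tri< b< _ _ = inj₁ b<
        ... | tri≈ _ b≡ _ = inj₂ (b≡ , x≢y , x≤y)
        ... | tri> _ _ b> = contradiction (le-antisym R x y x≤y (fwd y x b> (x≁y ∘ adj-sym G y x))) x≢y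
      from-⊑ : F._⊑_ x y → le R x y ≡ true
      from-⊑ (inj₁ refl)                          = le-refl R x
      from-⊑ (inj₂ (inj₁ b< , x≁y))               = fwd x y b< x≁y
      from-⊑ (inj₂ (inj₂ (_ , _ , x≤y) , _))      = x≤y

    forward⇒≅canonical : R ≅ canonical
    forward⇒≅canonical = ≅-trans {P = R} {F.poset} {canonical} (↔-refl , le≡forward)
      (umbrella-≅ (blockUmbrella forwardOrder) (blockUmbrella lexOrder) θ θ-order θ-adj)
      where
      iso = blockOrder-iso forwardOrder lexOrder
      θ = proj₁ iso
      θ-block = proj₁ (proj₂ iso)
      θ-order = proj₂ (proj₂ iso)
      θ-adj : ∀ x y → Adj G x y ⇔ Adj G (to θ x) (to θ y)
      θ-adj x y = mk⇔
        (adjacent ∘ subst₂ BlockAdj (sym (θ-block x)) (sym (θ-block y)) ∘ ⇒ (adj⇔ x y))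
        (adjacent ∘ subst₂ BlockAdj (θ-block x) (θ-block y) ∘ ⇒ (adj⇔ _ _))

  unique : ∀ {m} (P : FinPoset m) → IsIncomparabilityGraphOf G P → (P ≅ canonical) ⊎ (P ≅ dual canonical)
  unique P (φ , incG) = Data.Sum.map
    (≅-trans {P = P} {R} {canonical} P≅R ∘ forward⇒≅canonical R incG)
    (≅-trans {P = P} {R} {dual canonical} P≅R ∘ dual-≅ {P = dual R} {canonical}
      ∘ forward⇒≅canonical (dual R) (incomparabilityGraph-dual {G = G} {P = R} incG))
    (Orientation.orientation R incG)
    where
    R = pullback P φ
    P≅R : P ≅ R
    P≅R = ≅-sym {P = R} {P} (pullback-≅ P φ)

-- Every caterpillar has a block layout

-- A caterpillar without non-leaves is a single edge, laid out as a one-vertex spine with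
-- one leaf.
edgeLayout : ∀ {n} (G : Graph n) {v w} → Adj G v w → (∀ u → u ≡ v ⊎ u ≡ w) → CaterpillarLayout G
edgeLayout {n} G {v} {w} v~w span = record
  { block        = block
  ; top          = 0
  ; adj⇔         = λ x y → mk⇔ (to-blocks (span x) (span y)) (from-blocks (span x) (span y))
  ; spine-unique = λ bx by → spine-unique (span _) (span _) bx by
  ; block<       = λ x → block<2 (span x)
  ; spine        = λ { zero z≤n → v , block-v }
  ; first-leaf   = λ ()
  ; last-leaf    = λ ()
  }
  where
  Endpoint : Fin n → Set
  Endpoint x = x ≡ v ⊎ x ≡ w
  block : Fin n → ℕ
  block x = if does (x Fin.≟ v) then 0 else 1
  block-v : block v ≡ 0
  block-v = cong (λ b → if b then 0 else 1) (dec-true (v Fin.≟ v) refl)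
  block-w : block w ≡ 1
  block-w = cong (λ b → if b then 0 else 1) (dec-false (w Fin.≟ v) λ { refl → adj-irrefl G v~w })
  to-blocks : ∀ {x y} → Endpoint x → Endpoint y → Adj G x y → BlockAdj (block x) (block y)
  to-blocks (inj₁ refl) (inj₁ refl) x~y = contradiction x~y (adj-irrefl G)
  to-blocks (inj₁ refl) (inj₂ refl) _   = subst₂ BlockAdj (sym block-v) (sym block-w) (spine-leaf 0)
  to-blocks (inj₂ refl) (inj₁ refl) _   = subst₂ BlockAdj (sym block-w) (sym block-v) (BlockAdj-sym (spine-leaf 0))
  to-blocks (inj₂ refl) (inj₂ refl) x~y = contradiction x~y (adj-irrefl G)
  from-blocks : ∀ {x y} → Endpoint x → Endpoint y → BlockAdj (block x) (block y) → Adj G x y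
  from-blocks (inj₁ refl) (inj₁ refl) b~b = contradiction b~b BlockAdj-irrefl
  from-blocks (inj₁ refl) (inj₂ refl) _   = v~w
  from-blocks (inj₂ refl) (inj₁ refl) _   = adj-sym G v w v~w
  from-blocks (inj₂ refl) (inj₂ refl) b~b = contradiction b~b BlockAdj-irrefl
  spine-unique : ∀ {x y i} → Endpoint x → Endpoint y → block x ≡ double i → block y ≡ double i → x ≡ y
  spine-unique (inj₁ refl) (inj₁ refl) _ _ = refl
  spine-unique {i = i} (inj₂ refl) _ bx _ = contradiction (trans (sym bx) block-w) (double≢odd {i} {0})
  spine-unique {i = i} _ (inj₂ refl) _ by = contradiction (trans (sym by) block-w) (double≢odd {i} {0})
  block<2 : ∀ {x} → Endpoint x → block x < 2
  block<2 (inj₁ refl) = subst (_< 2) (sym block-v) (s≤s z≤n)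
  block<2 (inj₂ refl) = subst (_< 2) (sym block-w) ≤-refl

module SpineLayout {n} (G : Graph n) (conn : Connected G) (top : ℕ) (f : Fin (suc top) → Fin n)
  (f-injective : Injective _≡_ _≡_ f) (f-nonleaf : ∀ i → ¬ Leaf G (f i))
  (f-onto : ∀ v → ¬ Leaf G v → ∃[ i ] f i ≡ v)
  (f-path : ∀ i j → Adj G (f i) (f j) ⇔ (toℕ j ≡ suc (toℕ i) ⊎ toℕ i ≡ suc (toℕ j))) where

  Position : Fin n → Set
  Position x = (∃ λ i → f i ≡ x) ⊎ (∃ λ i → LeafAt G x (f i))

  position : ∀ x → Position x
  position x with leaf? G x
  ... | no x-nonleaf = inj₁ (f-onto x x-nonleaf)
  ... | yes (w , x-at-w) with leaf? G w
  ...   | yes w-leaf = contradiction (adjacent-leaves-span G conn x-at-w w-leaf (f zero))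
          [ (λ f₀≡x → f-nonleaf zero (subst (Leaf G) (sym f₀≡x) (w , x-at-w)))
          , (λ f₀≡w → f-nonleaf zero (subst (Leaf G) (sym f₀≡w) w-leaf)) ]
  ...   | no w-nonleaf with f-onto w w-nonleaf
  ...     | i , refl = inj₂ (i , x-at-w)

  positionBlock : ∀ {x} → Position x → ℕ
  positionBlock (inj₁ (i , _)) = double (toℕ i)
  positionBlock (inj₂ (i , _)) = suc (double (toℕ i))

  block : Fin n → ℕ
  block x = positionBlock (position x)

  positionBlock-spine : ∀ {x} (p : Position x) {i} → f i ≡ x → positionBlock p ≡ double (toℕ i)
  positionBlock-spine (inj₁ (j , fj≡x)) fi≡x = cong (double ∘ toℕ) (f-injective (trans fj≡x (sym fi≡x)))
  positionBlock-spine (inj₂ (j , x-at)) {i} refl = contradiction (_ , x-at) (f-nonleaf i)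

  positionBlock-leaf : ∀ {x} (p : Position x) {i} → LeafAt G x (f i) → positionBlock p ≡ suc (double (toℕ i))
  positionBlock-leaf (inj₁ (j , refl)) x-at = contradiction (_ , x-at) (f-nonleaf j)
  positionBlock-leaf (inj₂ (j , x-at′)) x-at =
    cong (suc ∘ double ∘ toℕ) (f-injective (sym (proj₂ x-at′ _ (proj₁ x-at))))

  View : Fin n → Set
  View x = (∃ λ i → f i ≡ x × block x ≡ double (toℕ i))
         ⊎ (∃ λ i → LeafAt G x (f i) × block x ≡ suc (double (toℕ i)))

  view : ∀ x → View x
  view x = by-position (position x)
    where
    by-position : Position x → View x
    by-position (inj₁ (i , fi≡x)) = inj₁ (i , fi≡x , positionBlock-spine (position x) fi≡x)
    by-position (inj₂ (i , x-at)) = inj₂ (i , x-at , positionBlock-leaf (position x) x-at)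

  to-blocks : ∀ {x y} → View x → View y → Adj G x y → BlockAdj (block x) (block y)
  to-blocks (inj₁ (i , refl , bx)) (inj₁ (j , refl , by)) x~y = subst₂ BlockAdj (sym bx) (sym by)
    ([ (λ j≡ → subst (BlockAdj (double (toℕ i)) ∘ double) (sym j≡) (spine-next (toℕ i)))
     , (λ i≡ → subst (λ k → BlockAdj (double k) (double (toℕ j))) (sym i≡)
                  (BlockAdj-sym (spine-next (toℕ j)))) ]
     (⇒ (f-path i j) x~y))
  to-blocks (inj₁ (i , refl , bx)) (inj₂ (j , y-at , by)) x~y with f-injective (proj₂ y-at _ (adj-sym G _ _ x~y))
  ... | refl = subst₂ BlockAdj (sym bx) (sym by) (spine-leaf (toℕ i))
  to-blocks (inj₂ (i , x-at , bx)) (inj₁ (j , refl , by)) x~y with f-injective (proj₂ x-at _ x~y)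
  ... | refl = subst₂ BlockAdj (sym bx) (sym by) (BlockAdj-sym (spine-leaf (toℕ i)))
  to-blocks (inj₂ (i , x-at , _)) (inj₂ (j , y-at , _)) x~y =
    contradiction (subst (Leaf G) (proj₂ x-at _ x~y) (_ , y-at)) (f-nonleaf i)

  from-blocks : ∀ {x y} → View x → View y → BlockAdj (block x) (block y) → Adj G x y
  from-blocks (inj₁ (i , refl , bx)) (inj₁ (j , refl , by)) b~b =
    ⇐ (f-path i j) (spine-spine (subst₂ BlockAdj bx by b~b))
  from-blocks (inj₁ (i , refl , bx)) (inj₂ (j , y-at , by)) b~b
    with toℕ-injective (spine-leaf⁻¹ (subst₂ BlockAdj bx by b~b))
  ... | refl = adj-sym G _ _ (proj₁ y-at)
  from-blocks (inj₂ (i , x-at , bx)) (inj₁ (j , refl , by)) b~b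
    with toℕ-injective (leaf-spine⁻¹ (subst₂ BlockAdj bx by b~b))
  ... | refl = proj₁ x-at
  from-blocks (inj₂ (_ , _ , bx)) (inj₂ (_ , _ , by)) b~b = contradiction (subst₂ BlockAdj bx by b~b) leaf-leaf

  spine-unique : ∀ {x y m} → block x ≡ double m → block y ≡ double m → x ≡ y
  spine-unique {x} {y} {m} bx by with view x | view y
  ... | inj₁ (i , refl , bx′) | inj₁ (j , refl , by′) =
    cong f (toℕ-injective (double-injective (trans (sym bx′) (trans bx (trans (sym by) by′)))))
  ... | inj₂ (i , _ , bx′) | _ = contradiction (trans (sym bx) bx′) (double≢odd {m} {toℕ i})
  ... | inj₁ _ | inj₂ (j , _ , by′) = contradiction (trans (sym by) by′) (double≢odd {m} {toℕ j})

  leaf<top : ∀ (i : Fin (suc top)) → suc (double (toℕ i)) < double (suc top)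
  leaf<top i = s≤s (s≤s (double-mono-≤ (≤-pred (toℕ<n i))))

  block< : ∀ x → block x < double (suc top)
  block< x with view x
  ... | inj₁ (i , _ , bx) = subst (_< _) (sym bx) (<-trans (n<1+n _) (leaf<top i))
  ... | inj₂ (i , _ , bx) = subst (_< _) (sym bx) (leaf<top i)

  spine : ∀ i → i ≤ top → ∃ λ x → block x ≡ double i
  spine i i≤top =
    f i′ , trans (positionBlock-spine (position (f i′)) refl) (cong double (toℕ-fromℕ< (s≤s i≤top)))
    where i′ = fromℕ< (s≤s i≤top)

  end-leaf : ∀ i j → Adj G (f i) (f j) → (∀ j′ → Adj G (f i) (f j′) → j′ ≡ j) →
    ∃ λ z → block z ≡ suc (double (toℕ i))
  end-leaf i j fi~fj only-j with any? (λ z → (adj G (f i) z Bool.≟ true) ×-dec ¬? (z Fin.≟ f j))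
  ... | yes (z , fi~z , z≢fj) = z , leaf-block (view z)
    where
    leaf-block : View z → block z ≡ suc (double (toℕ i))
    leaf-block (inj₁ (j′ , refl , _)) = contradiction (cong f (only-j j′ fi~z)) z≢fj
    leaf-block (inj₂ (i′ , z-at , bz)) with f-injective (proj₂ z-at (f i) (adj-sym G _ _ fi~z))
    ... | refl = bz
  ... | no none = contradiction (f j , fi~fj , only-fj) (f-nonleaf i)
    where
    only-fj : ∀ z → Adj G (f i) z → z ≡ f j
    only-fj z fi~z = decidable-stable (z Fin.≟ f j) λ z≢fj → none (z , fi~z , z≢fj)

  first-leaf : 1 ≤ top → ∃ λ x → block x ≡ 1
  first-leaf 1≤top = end-leaf zero j (⇐ (f-path zero j) (inj₁ toℕ-j)) only-j
    where
    j : Fin (suc top)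
    j = fromℕ< (s≤s 1≤top)
    toℕ-j : toℕ j ≡ 1
    toℕ-j = toℕ-fromℕ< (s≤s 1≤top)
    only-j : ∀ j′ → Adj G (f zero) (f j′) → j′ ≡ j
    only-j j′ f₀~fj′ with ⇒ (f-path zero j′) f₀~fj′
    ... | inj₁ toℕ-j′ = toℕ-injective (trans toℕ-j′ (sym toℕ-j))

  last-leaf : 1 ≤ top → ∃ λ x → block x ≡ suc (double top)
  last-leaf (s≤s {n = t} z≤n) = map₂ (λ bz → trans bz (cong (suc ∘ double) (toℕ-fromℕ top)))
    (end-leaf (fromℕ top) j (⇐ (f-path (fromℕ top) j) (inj₂ toℕ-top≡1+j)) only-j)
    where
    j : Fin (suc top)
    j = fromℕ< (s≤s (n≤1+n t))
    toℕ-j : toℕ j ≡ t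
    toℕ-j = toℕ-fromℕ< (s≤s (n≤1+n t))
    toℕ-top≡1+j : toℕ (fromℕ top) ≡ suc (toℕ j)
    toℕ-top≡1+j = trans (toℕ-fromℕ top) (cong suc (sym toℕ-j))
    only-j : ∀ j′ → Adj G (f (fromℕ top)) (f j′) → j′ ≡ j
    only-j j′ ftop~fj′ with ⇒ (f-path (fromℕ top) j′) ftop~fj′
    ... | inj₁ toℕ-j′ = contradiction (toℕ<n j′) (<-irrefl (trans toℕ-j′ (cong suc (toℕ-fromℕ top))))
    ... | inj₂ toℕ-top = toℕ-injective (suc-injective (trans (sym toℕ-top) toℕ-top≡1+j))

  layout : CaterpillarLayout G
  layout = record
    { block        = block
    ; top          = top
    ; adj⇔         = λ x y → mk⇔ (to-blocks (view x) (view y)) (from-blocks (view x) (view y))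
    ; spine-unique = spine-unique
    ; block<       = block<
    ; spine        = spine
    ; first-leaf   = first-leaf
    ; last-leaf    = last-leaf
    }

caterpillarLayout : ∀ {n} (G : Graph n) → Caterpillar G → CaterpillarLayout G
caterpillarLayout G ((v , conn , _) , zero , _ , _ , _ , nonleaf-onto , _) =
  edgeLayout G v~w (adjacent-leaves-span G conn v-at-w (every-leaf w))
  where
  every-leaf : ∀ u → Leaf G u
  every-leaf u = decidable-stable (leaf? G u) λ u-nonleaf → ¬Fin0 (proj₁ (nonleaf-onto u u-nonleaf))
  w = proj₁ (every-leaf v)
  v-at-w = proj₂ (every-leaf v)
  v~w = proj₁ v-at-w
caterpillarLayout G ((_ , conn , _) , suc top , f , f-injective , f-nonleaf , f-onto , f-path) =
  SpineLayout.layout G conn top f f-injective f-nonleaf f-onto f-path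

proposition6p3 : ∀ {n} (G : Graph n) → Caterpillar G →
    (∃[ m ] Σ (FinPoset m) λ P → IsTwoChain P × IsIncomparabilityGraphOf G P)
    × (∀ {m k} (P : FinPoset m) (Q : FinPoset k) →
        IsTwoChain P → IsIncomparabilityGraphOf G P →
        IsTwoChain Q → IsIncomparabilityGraphOf G Q →
        (P ≅ Q) ⊎ (P ≅ dual Q))
proposition6p3 {n} G caterpillar =
  (n , canonical , canonical-isTwoChain connected , ↔-refl , canonical-incomparabilityGraph) ,
  λ P Q _ P-inc _ Q-inc → ≅-up-to-duality {P = P} {Q} {canonical} (unique P P-inc) (unique Q Q-inc)
  where
  connected : Connected G
  connected = proj₁ (proj₂ (proj₁ caterpillar))
  open Layout (caterpillarLayout G caterpillar)
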